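{- Let $n,k$ be positive integers with $k<n-1$, let $1<i<n$, and $r=v_i$ in $P_n^{(k)}$. Then for every $t\ge1$, \[\pi_t(P_n^{(k)},r)=\max_{t_1+t_2=t+1,\ t_1,t_2\ge 1}\Big(\pi_{t_1}(P_{n_1}^{(k)},r_1)+\pi_{t_2}(P_{n_2}^{(k)},r_2)-1\Big),\] where $n_1=i$, $n_2=n-i+1$ (so $n_1+n_2=n+1$), $r_1$ is an end vertex (simplicial vertex) of $P_{n_1}^{(k)}$ and $r_2$ is an end vertex of $P_{n_2}^{(k)}$. (These two graphs are the ones obtained from $P_n^{(k)}$ by deleting all edges $v_hv_j$ with $h<i<j$ between neighbors of $r$: the subgraphs induced by $\{v_1,\dots,v_i\}$ and $\{v_i,\dots,v_n\}$, joined at $r$, which is simplicial in both.)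
   Context: $P_n^{(k)}$ is the graph with vertices $v_1,\dots,v_n$ where $v_i\sim v_j$ iff $1\le|i-j|\le k$. A configuration on a graph $H$ is $C:V(H)\to\mathbb{N}$; a pebbling step from a vertex with at least two pebbles to a neighbor removes two pebbles there and adds one to the neighbor. $\pi_t(H,r)$ is the least $m$ such that every configuration of $m$ pebbles on $H$ admits a sequence of pebbling steps placing at least $t$ pebbles on $r$. -}

module Defs where

open import Data.Nat using (ℕ; zero; suc; _+_; _∸_; _≤_; _<_; _⊔_; ∣_-_∣)
open import Data.Fin using (Fin; toℕ)
open import Data.List using (List; map; foldr; applyUpTo)
open import Data.Nat.ListAction using (sum)
import Data.List as L
open import Data.Product using (Σ; ∃; _×_)
open import Relation.Binary.PropositionalEquality using (_≡_; _≢_)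
open import Relation.Binary.Construct.Closure.ReflexiveTransitive using (Star)
open import Relation.Nullary using (¬_)

-- Vertices of P_n^{(k)} : Fin n, where index j stands for v_{j+1}.
-- Adjacency in P_n^{(k)}: v_i ~ v_j iff 1 ≤ |i - j| ≤ k.
Adj : (n k : ℕ) → Fin n → Fin n → Set
Adj n k u w = 1 ≤ ∣ toℕ u - toℕ w ∣ × ∣ toℕ u - toℕ w ∣ ≤ k

Config : ℕ → Set
Config n = Fin n → ℕ

size : {n : ℕ} → Config n → ℕ
size {n} C = sum (L.tabulate C)

Step : (n k : ℕ) → Config n → Config n → Set
Step n k C D =
  Σ (Fin n) λ u → Σ (Fin n) λ w →
    Adj n k u w × 2 ≤ C u × D u + 2 ≡ C u × D w ≡ suc (C w) ×
    ((x : Fin n) → x ≢ u → x ≢ w → D x ≡ C x)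

Solvable : (n k : ℕ) → Fin n → ℕ → Config n → Set
Solvable n k r t C = ∃ λ D → Star (Step n k) C D × t ≤ D r

AllSolvable : (n k : ℕ) → Fin n → ℕ → ℕ → Set
AllSolvable n k r t m = (C : Config n) → size C ≡ m → Solvable n k r t C

IsPebblingNumber : (n k : ℕ) → Fin n → ℕ → ℕ → Set
IsPebblingNumber n k r t m =
  AllSolvable n k r t m × ((m' : ℕ) → m' < m → ¬ AllSolvable n k r t m')

-- max_{t₁ + t₂ = t + 1, t₁,t₂ ≥ 1} (f t₁ + g t₂ - 1), i.e. t₁ ranges over 1..t and t₂ = t + 1 - t₁.
maxSplit : (ℕ → ℕ) → (ℕ → ℕ) → ℕ → ℕ
maxSplit f g t = foldr _⊔_ 0 (map (λ t₁ → f t₁ + g (suc t ∸ t₁) ∸ 1) (applyUpTo suc t))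

module Submission where

-- Cutting P_n^{(k)} at r = v_i gives its sides v_1 … v_i and v_i … v_n, copies of P_i^{(k)} and
-- P_{n-i+1}^{(k)} meeting only in r; an edge between the sides that avoids r can be replaced by an
-- edge to r.
-- Upper bound: split a configuration into its left part (with r) and its right part (without r),
-- and aim for j pebbles from the left, raising j while the left part holds π_{j+1} pebbles; when it
-- stops, maximality of the bound leaves π_{t-j} pebbles on the right, and both solutions run side
-- by side.
-- Lower bound: a left configuration of π_{t₁} - 1 pebbles that cannot put t₁ on r and a right one of
-- π_{t₂} - 1 pebbles that cannot put t₂ together cannot put t₁ + t₂ - 1 = t on r. Indeed every
-- reachable configuration splits into a left part that cannot put a + 1 on r and a right part that
-- cannot put b + 1, with a + b = t - 1: a step across the cut is replayed as a step to r followed by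
-- handing that pebble to the other side, which costs the giver one unit of reach and gains the
-- receiver at most one.

open import Defs
open import Data.Nat using (ℕ; zero; suc; _+_; _∸_; _≤_; _<_; _⊔_; ∣_-_∣; z≤n; s≤s; _≤?_)
open import Data.Nat.Properties hiding (_≟_)
open import Data.Nat.ListAction using (sum)
open import Data.Nat.Tactic.RingSolver using (solve-∀)
open import Data.Fin using (Fin; toℕ; zero; suc; _≟_; fromℕ; fromℕ<; inject₁; inject≤; cast; _↑ˡ_; _↑ʳ_)
open import Data.Fin.Properties
  using (any?; toℕ-injective; cast-is-id; toℕ-fromℕ; toℕ-fromℕ<; toℕ<n; toℕ-inject₁; toℕ-inject≤; toℕ-cast; toℕ-↑ˡ; toℕ-↑ʳ)
import Data.Fin.Properties as Finₚ
open import Data.List using (List; _∷_; foldr)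
open import Data.List.Relation.Unary.Any using (Any; here; there)
import Data.List.Relation.Unary.Any.Properties as Any
open import Data.List.Properties using (tabulate-cong)
open import Data.Vec.Functional using (updateAt)
open import Data.Vec.Functional.Properties using (updateAt-updates; updateAt-minimal)
open import Data.Product using (Σ; ∃; ∃-syntax; _×_; _,_; proj₁; proj₂)
open import Data.Sum using (_⊎_; inj₁; inj₂)
open import Data.Empty using (⊥; ⊥-elim)
open import Function using (_∘_; const)
open import Relation.Nullary using (¬_; Dec; yes; no)
open import Relation.Nullary.Decidable using (_×-dec_; _⊎-dec_; map′; decidable-stable)
open import Relation.Binary.PropositionalEquality
open import Relation.Binary.Construct.Closure.ReflexiveTransitive using (Star; ε; _◅_; _◅◅_; gmap)

private variable
  m k t : ℕ

infixl 6 _⊕_ _⊖_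

_⊕_ _⊖_ : Config m → Config m → Config m
(C ⊕ D) x = C x + D x
(C ⊖ D) x = C x ∸ D x

pebble : Fin m → Config m
pebble v = updateAt (const 0) v suc

pebble-here : (v : Fin m) → pebble v v ≡ 1
pebble-here v = updateAt-updates v (const 0)

pebble-elsewhere : {v x : Fin m} → x ≢ v → pebble v x ≡ 0
pebble-elsewhere {v = v} {x} x≢v = updateAt-minimal x v (const 0) x≢v

pebble≤ : {C : Config m} {v : Fin m} → 1 ≤ C v → (x : Fin m) → pebble v x ≤ C x
pebble≤ {v = v} 1≤Cv x with x ≟ v
... | yes refl = subst (_≤ _) (sym (pebble-here v)) 1≤Cv
... | no x≢v = subst (_≤ _) (sym (pebble-elsewhere x≢v)) z≤n

pebble≤1 : (v x : Fin m) → pebble v x ≤ 1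
pebble≤1 v x = pebble≤ {C = const 1} ≤-refl x

⊖-pebble-⊕ : {C : Config m} {v : Fin m} → 1 ≤ C v → (C ⊖ pebble v) ⊕ pebble v ≗ C
⊖-pebble-⊕ 1≤Cv x = m∸n+n≡m (pebble≤ 1≤Cv x)

move : Config m → Fin m → Fin m → Config m
move C u w = updateAt (updateAt C u (_∸ 2)) w suc

module _ {C : Config m} {u w : Fin m} (u≢w : u ≢ w) where

  move-source : move C u w u ≡ C u ∸ 2
  move-source = trans (updateAt-minimal u w _ u≢w) (updateAt-updates u C)

  move-target : move C u w w ≡ suc (C w)
  move-target = trans (updateAt-updates w _) (cong suc (updateAt-minimal w u C (u≢w ∘ sym)))

move-other : {C : Config m} {u w x : Fin m} → x ≢ u → x ≢ w → move C u w x ≡ C x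
move-other {u = u} {w} {x} x≢u x≢w = trans (updateAt-minimal x w _ x≢w) (updateAt-minimal x u _ x≢u)

≗move : {C D : Config m} {u w : Fin m} → u ≢ w →
        D u ≡ C u ∸ 2 → D w ≡ suc (C w) → (∀ x → x ≢ u → x ≢ w → D x ≡ C x) → D ≗ move C u w
≗move {u = u} {w} u≢w Du Dw Dx x with x ≟ u | x ≟ w
... | yes refl | _ = trans Du (sym (move-source u≢w))
... | no _ | yes refl = trans Dw (sym (move-target u≢w))
... | no x≢u | no x≢w = trans (Dx x x≢u x≢w) (sym (move-other x≢u x≢w))

move-cong : {C C′ : Config m} {u w : Fin m} → u ≢ w → C ≗ C′ → move C u w ≗ move C′ u w
move-cong {C = C} {C′} u≢w C≗C′ = ≗move u≢w
  (trans (move-source u≢w) (cong (_∸ 2) (C≗C′ _)))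
  (trans (move-target u≢w) (cong suc (C≗C′ _)))
  (λ x x≢u x≢w → trans (move-other x≢u x≢w) (C≗C′ x))

move-⊕ : {C X : Config m} {u w : Fin m} → u ≢ w → 2 ≤ C u → move C u w ⊕ X ≗ move (C ⊕ X) u w
move-⊕ {C = C} {X} {u} {w} u≢w 2≤Cu = ≗move u≢w
  (trans (cong (_+ X u) (move-source u≢w)) (sym (+-∸-comm (X u) 2≤Cu)))
  (cong (_+ X w) (move-target u≢w))
  (λ x x≢u x≢w → cong (_+ X x) (move-other x≢u x≢w))

move-spent : {C : Config m} {u w : Fin m} → u ≢ w → C u ≤ 1 →
             (C ⊖ pebble u) ⊕ pebble w ≗ move (C ⊕ pebble u) u w
move-spent {C = C} {u} {w} u≢w Cu≤1 = ≗move u≢w at-u at-w elsewhere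
  where
  spent : ∀ {c} → c ≤ 1 → c ∸ 1 + 0 ≡ c + 1 ∸ 2
  spent z≤n = refl
  spent (s≤s z≤n) = refl
  at-u : C u ∸ pebble u u + pebble w u ≡ C u + pebble u u ∸ 2
  at-u rewrite pebble-here u | pebble-elsewhere {v = w} u≢w = spent Cu≤1
  at-w : C w ∸ pebble u w + pebble w w ≡ suc (C w + pebble u w)
  at-w rewrite pebble-here w | pebble-elsewhere {v = u} (u≢w ∘ sym) =
    trans (+-comm (C w) 1) (cong suc (sym (+-identityʳ (C w))))
  elsewhere : ∀ x → x ≢ u → x ≢ w → C x ∸ pebble u x + pebble w x ≡ C x + pebble u x
  elsewhere x x≢u x≢w rewrite pebble-elsewhere x≢u | pebble-elsewhere x≢w = refl

move-reroute : {D : Config m} {u v w : Fin m} → u ≢ v → w ≢ v → u ≢ w →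
               (move D u v ⊖ pebble v) ⊕ pebble w ≗ move D u w
move-reroute {D = D} {u} {v} {w} u≢v w≢v u≢w = ≗move u≢w at-u at-w elsewhere
  where
  at-u : move D u v u ∸ pebble v u + pebble w u ≡ D u ∸ 2
  at-u rewrite move-source {C = D} u≢v | pebble-elsewhere {v = v} u≢v | pebble-elsewhere {v = w} u≢w =
    +-identityʳ (D u ∸ 2)
  at-w : move D u v w ∸ pebble v w + pebble w w ≡ suc (D w)
  at-w rewrite move-other {C = D} (u≢w ∘ sym) w≢v | pebble-elsewhere {v = v} w≢v | pebble-here w =
    +-comm (D w) 1
  elsewhere : ∀ x → x ≢ u → x ≢ w → move D u v x ∸ pebble v x + pebble w x ≡ D x
  elsewhere x x≢u x≢w with x ≟ v
  ... | yes refl rewrite move-target {C = D} u≢v | pebble-here v | pebble-elsewhere {v = w} x≢w =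
    +-identityʳ (D x)
  ... | no x≢v rewrite move-other {C = D} x≢u x≢v | pebble-elsewhere {v = v} x≢v | pebble-elsewhere {v = w} x≢w =
    +-identityʳ (D x)

size-cong : {C D : Config m} → C ≗ D → size C ≡ size D
size-cong C≗D = cong sum (tabulate-cong C≗D)

size-zero : {C : Config m} → (∀ x → C x ≡ 0) → size C ≡ 0
size-zero {zero} _ = refl
size-zero {suc m} C≡0 = cong₂ _+_ (C≡0 zero) (size-zero (C≡0 ∘ suc))

size-concentrated : {C : Config m} (v : Fin m) → (∀ x → x ≢ v → C x ≡ 0) → size C ≡ C v
size-concentrated {suc m} {C} zero C≡0 =
  trans (cong (C zero +_) (size-zero (λ x → C≡0 (suc x) λ ()))) (+-identityʳ (C zero))
size-concentrated {suc m} (suc v) C≡0 =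
  cong₂ _+_ (C≡0 zero λ ()) (size-concentrated v (λ x x≢v → C≡0 (suc x) (x≢v ∘ Finₚ.suc-injective)))

size-⊕ : (C D : Config m) → size (C ⊕ D) ≡ size C + size D
size-⊕ {zero} C D = refl
size-⊕ {suc m} C D =
  trans (cong (C zero + D zero +_) (size-⊕ (C ∘ suc) (D ∘ suc)))
        (interchange (C zero) (D zero) (size (C ∘ suc)) (size (D ∘ suc)))
  where
  interchange : ∀ a b c d → a + b + (c + d) ≡ a + c + (b + d)
  interchange = solve-∀

size-updateAt : (C : Config m) (v : Fin m) (f : ℕ → ℕ) → size (updateAt C v f) + C v ≡ size C + f (C v)
size-updateAt {suc m} C zero f = rotate (f (C zero)) (size (C ∘ suc)) (C zero)
  where
  rotate : ∀ a b c → a + b + c ≡ c + b + a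
  rotate = solve-∀
size-updateAt {suc m} C (suc v) f = begin
  C zero + size (updateAt (C ∘ suc) v f) + C (suc v)   ≡⟨ +-assoc (C zero) _ _ ⟩
  C zero + (size (updateAt (C ∘ suc) v f) + C (suc v)) ≡⟨ cong (C zero +_) (size-updateAt (C ∘ suc) v f) ⟩
  C zero + (size (C ∘ suc) + f (C (suc v)))            ≡⟨ +-assoc (C zero) _ _ ⟨
  C zero + size (C ∘ suc) + f (C (suc v))              ∎
  where open ≡-Reasoning

size-move : {C : Config m} {u w : Fin m} → 2 ≤ C u → u ≢ w → suc (size (move C u w)) ≡ size C
size-move {C = C} {u} {w} 2≤Cu u≢w = +-cancelʳ-≡ (C u ∸ 2) _ _ (begin
  suc (size (move C u w)) + (C u ∸ 2) ≡⟨ cong (λ s → suc s + (C u ∸ 2)) moved ⟩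
  2 + size C₁ + (C u ∸ 2)             ≡⟨ shuffle (size C₁) (C u ∸ 2) ⟩
  size C₁ + ((C u ∸ 2) + 2)           ≡⟨ cong (size C₁ +_) (m∸n+n≡m 2≤Cu) ⟩
  size C₁ + C u                       ≡⟨ size-updateAt C u (_∸ 2) ⟩
  size C + (C u ∸ 2)                  ∎)
  where
  open ≡-Reasoning
  C₁ = updateAt C u (_∸ 2)
  moved : size (move C u w) ≡ suc (size C₁)
  moved = +-cancelʳ-≡ (C₁ w) _ _ (trans (size-updateAt C₁ w suc) (+-suc (size C₁) (C₁ w)))
  shuffle : ∀ a b → 2 + a + b ≡ a + (b + 2)
  shuffle = solve-∀

sub-config : (C : Config m) {j : ℕ} → j ≤ size C → ∃[ E ] (∀ x → E x ≤ C x) × size E ≡ j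
sub-config {zero} C z≤n = C , (λ _ → ≤-refl) , refl
sub-config {suc m} C {j} j≤size with j ≤? C zero
... | yes j≤C₀ = E , E≤C , trans (cong (j +_) (size-zero {C = E ∘ suc} λ _ → refl)) (+-identityʳ j)
  where
  E : Config (suc m)
  E zero = j
  E (suc _) = 0
  E≤C : ∀ x → E x ≤ C x
  E≤C zero = j≤C₀
  E≤C (suc _) = z≤n
... | no j≰C₀ with sub-config (C ∘ suc) {j ∸ C zero}
                     (≤-trans (∸-monoˡ-≤ (C zero) j≤size) (≤-reflexive (m+n∸m≡n (C zero) _)))
...   | E′ , E′≤C , size-E′ =
  E , E≤C , trans (cong (C zero +_) size-E′) (m+[n∸m]≡n (<⇒≤ (≰⇒> j≰C₀)))
  where
  E : Config (suc m)
  E zero = C zero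
  E (suc x) = E′ x
  E≤C : ∀ x → E x ≤ C x
  E≤C zero = ≤-refl
  E≤C (suc x) = E′≤C x

size-↑ : (a b : ℕ) (C : Config (a + b)) → size C ≡ size (C ∘ (_↑ˡ b)) + size (C ∘ (a ↑ʳ_))
size-↑ zero b C = refl
size-↑ (suc a) b C = trans (cong (C zero +_) (size-↑ a b (C ∘ suc))) (sym (+-assoc (C zero) _ _))

size-cast : {a b : ℕ} (eq : a ≡ b) (C : Config b) → size (C ∘ cast eq) ≡ size C
size-cast refl C = size-cong (cong C ∘ cast-is-id refl)

size-inject₁ : (C : Config (suc m)) → size C ≡ size (C ∘ inject₁) + C (fromℕ m)
size-inject₁ {zero} C = +-comm (C zero) 0
size-inject₁ {suc m} C = trans (cong (C zero +_) (size-inject₁ (C ∘ suc))) (sym (+-assoc (C zero) _ _))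

adj≢ : {u w : Fin m} → Adj m k u w → u ≢ w
adj≢ {u = u} (0<dist , _) refl = <-irrefl (sym (∣n-n∣≡0 (toℕ u))) 0<dist

adj? : (u w : Fin m) → Dec (Adj m k u w)
adj? {k = k} u w = (1 ≤? ∣ toℕ u - toℕ w ∣) ×-dec (∣ toℕ u - toℕ w ∣ ≤? k)

step-move : {C : Config m} {u w : Fin m} → Adj m k u w → 2 ≤ C u → Step m k C (move C u w)
step-move {u = u} {w} adj 2≤Cu =
  u , w , adj , 2≤Cu , trans (cong (_+ 2) (move-source u≢w)) (m∸n+n≡m 2≤Cu) ,
  move-target u≢w , λ x → move-other
  where
  u≢w : u ≢ w
  u≢w = adj≢ adj

step≗move : {C D : Config m} (s : Step m k C D) → D ≗ move C (proj₁ s) (proj₁ (proj₂ s))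
step≗move {C = C} {D} (u , w , adj , _ , Du+2≡Cu , Dw , Dx) =
  ≗move (adj≢ adj) (trans (sym (m+n∸n≡m (D u) 2)) (cong (_∸ 2) Du+2≡Cu)) Dw Dx

step-resp : {C C′ D D′ : Config m} → C ≗ C′ → D ≗ D′ → Step m k C D → Step m k C′ D′
step-resp C≗C′ D≗D′ (u , w , adj , 2≤Cu , Du+2≡Cu , Dw , Dx) =
  u , w , adj , subst (2 ≤_) (C≗C′ u) 2≤Cu ,
  trans (cong (_+ 2) (sym (D≗D′ u))) (trans Du+2≡Cu (C≗C′ u)) ,
  trans (sym (D≗D′ w)) (trans Dw (cong suc (C≗C′ w))) ,
  λ x x≢u x≢w → trans (sym (D≗D′ x)) (trans (Dx x x≢u x≢w) (C≗C′ x))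

step-⊕ʳ : {C D : Config m} (X : Config m) → Step m k C D → Step m k (C ⊕ X) (D ⊕ X)
step-⊕ʳ {D = D} X (u , w , adj , 2≤Cu , Du+2≡Cu , Dw , Dx) =
  u , w , adj , ≤-trans 2≤Cu (m≤m+n _ (X u)) ,
  trans (+-right-comm (D u) (X u) 2) (cong (_+ X u) Du+2≡Cu) ,
  cong (_+ X w) Dw , λ x x≢u x≢w → cong (_+ X x) (Dx x x≢u x≢w)
  where
  +-right-comm : ∀ a b c → a + b + c ≡ a + c + b
  +-right-comm = solve-∀

step-⊕ˡ : {C D : Config m} (X : Config m) → Step m k C D → Step m k (X ⊕ C) (X ⊕ D)
step-⊕ˡ {C = C} {D} X = step-resp (λ x → +-comm (C x) (X x)) (λ x → +-comm (D x) (X x)) ∘ step-⊕ʳ X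

star-resp : {C C′ D : Config m} → Star (Step m k) C D → C ≗ C′ →
            ∃[ D′ ] Star (Step m k) C′ D′ × D ≗ D′
star-resp {C′ = C′} ε C≗C′ = C′ , ε , C≗C′
star-resp (s ◅ steps) C≗C′ = _ , step-resp C≗C′ (λ _ → refl) s ◅ steps , λ _ → refl

module _ {m k : ℕ} {o : Fin m} where

  solvable-at-root : {C : Config m} → t ≤ C o → Solvable m k o t C
  solvable-at-root t≤Co = _ , ε , t≤Co

  solvable-zero : {C : Config m} → Solvable m k o 0 C
  solvable-zero = solvable-at-root z≤n

  unsolvable⇒root≤ : {C : Config m} {a : ℕ} → ¬ Solvable m k o (suc a) C → C o ≤ a
  unsolvable⇒root≤ {C = C} {a} unsolvable with suc a ≤? C o
  ... | yes a<Co = ⊥-elim (unsolvable (solvable-at-root a<Co))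
  ... | no a≮Co = ≤-pred (≰⇒> a≮Co)

  solvable-step : {C C′ : Config m} → Step m k C C′ → Solvable m k o t C′ → Solvable m k o t C
  solvable-step s (D , steps , t≤Do) = D , s ◅ steps , t≤Do

  solvable-resp : {C C′ : Config m} → C ≗ C′ → Solvable m k o t C → Solvable m k o t C′
  solvable-resp C≗C′ (D , steps , t≤Do) with star-resp steps C≗C′
  ... | D′ , steps′ , D≗D′ = D′ , steps′ , subst (_ ≤_) (D≗D′ o) t≤Do

  solvable-⊕ : {C C′ : Config m} {t′ : ℕ} →
               Solvable m k o t C → Solvable m k o t′ C′ → Solvable m k o (t + t′) (C ⊕ C′)
  solvable-⊕ {C′ = C′} (D , steps , t≤Do) (D′ , steps′ , t′≤D′o) =
    D ⊕ D′ , gmap (_⊕ C′) (step-⊕ʳ C′) steps ◅◅ gmap (D ⊕_) (step-⊕ˡ D) steps′ ,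
    +-mono-≤ t≤Do t′≤D′o

  solvable-mono : {C C′ : Config m} → (∀ x → C x ≤ C′ x) → Solvable m k o t C → Solvable m k o t C′
  solvable-mono {t = t} {C} {C′} C≤C′ solvable =
    solvable-resp (λ x → m+[n∸m]≡n (C≤C′ x))
      (subst (λ s → Solvable m k o s (C ⊕ (C′ ⊖ C))) (+-identityʳ t) (solvable-⊕ solvable solvable-zero))

  solvable-root : {C : Config m} → Solvable m k o t C → Solvable m k o (suc t) (C ⊕ pebble o)
  solvable-root {t = t} {C} solvable = subst (λ s → Solvable m k o s (C ⊕ pebble o)) (+-comm t 1)
    (solvable-⊕ solvable (solvable-at-root {C = pebble o} (≤-reflexive (sym (pebble-here o)))))

  -- A step that C cannot make uses the extra pebble at v and C's single pebble
  -- there; afterwards the state is C ⊖ pebble v plus an extra pebble at the target, and C ⊖ pebble v ≤ C.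
  solvable-unpebble : {C : Config m} {v : Fin m} →
                      Solvable m k o (suc t) (C ⊕ pebble v) → Solvable m k o t C
  solvable-unpebble (D , steps , t<Do) = go steps (λ _ → refl) t<Do
    where
    go : ∀ {t} {F D C : Config m} {v} → Star (Step m k) F D → F ≗ C ⊕ pebble v →
         suc t ≤ D o → Solvable m k o t C
    go {C = C} {v} ε F≗ t<Fo = solvable-at-root (≤-pred (begin
      _                ≤⟨ t<Fo ⟩
      _                ≡⟨ F≗ o ⟩
      C o + pebble v o ≤⟨ +-monoʳ-≤ (C o) (pebble≤1 v o) ⟩
      C o + 1          ≡⟨ +-comm (C o) 1 ⟩
      suc (C o)        ∎))
      where open ≤-Reasoning
    go {C = C} {v} (s@(u , w , adj , 2≤Fu , _) ◅ steps) F≗ t<Do with 2 ≤? C u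
    ... | yes 2≤Cu = solvable-step (step-move adj 2≤Cu) (go steps (λ x → begin
      _                              ≡⟨ step≗move s x ⟩
      move _ u w x                   ≡⟨ move-cong (adj≢ adj) F≗ x ⟩
      move (C ⊕ pebble v) u w x      ≡⟨ move-⊕ (adj≢ adj) 2≤Cu x ⟨
      (move C u w ⊕ pebble v) x      ∎) t<Do)
      where open ≡-Reasoning
    ... | no 2≰Cu with v ≟ u
    ...   | no v≢u = ⊥-elim (2≰Cu (subst (2 ≤_) Fu≡Cu 2≤Fu))
      where
      Fu≡Cu : _ ≡ C u
      Fu≡Cu = trans (F≗ u) (trans (cong (C u +_) (pebble-elsewhere (v≢u ∘ sym))) (+-identityʳ (C u)))
    ...   | yes refl = solvable-mono (λ x → m∸n≤m (C x) (pebble v x)) (go steps (λ x → begin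
      _                                 ≡⟨ step≗move s x ⟩
      move _ u w x                      ≡⟨ move-cong (adj≢ adj) F≗ x ⟩
      move (C ⊕ pebble u) u w x         ≡⟨ move-spent (adj≢ adj) (≤-pred (≰⇒> 2≰Cu)) x ⟨
      ((C ⊖ pebble u) ⊕ pebble w) x     ∎) t<Do)
      where open ≡-Reasoning

  allSolvable-≥ : {j : ℕ} → AllSolvable m k o t j → (C : Config m) → j ≤ size C → Solvable m k o t C
  allSolvable-≥ all C j≤size with sub-config C j≤size
  ... | E , E≤C , size-E = solvable-mono E≤C (all E size-E)

  SolvableWithin : ℕ → ℕ → Config m → Set
  SolvableWithin t zero C = t ≤ C o
  SolvableWithin t (suc f) C =
    t ≤ C o ⊎ ∃[ u ] ∃[ w ] (Adj m k u w × 2 ≤ C u) × SolvableWithin t f (move C u w)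

  solvableWithin? : ∀ t f C → Dec (SolvableWithin t f C)
  solvableWithin? t zero C = t ≤? C o
  solvableWithin? t (suc f) C = t ≤? C o ⊎-dec any? λ u → any? λ w →
    (adj? u w ×-dec 2 ≤? C u) ×-dec solvableWithin? t f (move C u w)

  solvableWithin⇒solvable : ∀ f {C} → SolvableWithin t f C → Solvable m k o t C
  solvableWithin⇒solvable zero t≤Co = solvable-at-root t≤Co
  solvableWithin⇒solvable (suc f) (inj₁ t≤Co) = solvable-at-root t≤Co
  solvableWithin⇒solvable (suc f) (inj₂ (u , w , (adj , 2≤Cu) , within)) =
    solvable-step (step-move adj 2≤Cu) (solvableWithin⇒solvable f within)

  -- Each step loses a pebble, so size C steps suffice.
  star⇒solvableWithin : ∀ f {C D} → Star (Step m k) C D → size C ≤ f → t ≤ D o → SolvableWithin t f C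
  star⇒solvableWithin zero ε _ t≤Co = t≤Co
  star⇒solvableWithin (suc f) ε _ t≤Co = inj₁ t≤Co
  star⇒solvableWithin zero {C} (s@(u , w , adj , 2≤Cu , _) ◅ _) size≤0 _ =
    ⊥-elim (n≮0 (≤-trans (≤-reflexive (size-move {C = C} 2≤Cu (adj≢ adj))) size≤0))
  star⇒solvableWithin (suc f) {C} (s@(u , w , adj , 2≤Cu , _) ◅ steps) size≤ t≤Do
    with star-resp steps (step≗move s)
  ... | D′ , steps′ , D≗D′ = inj₂ (u , w , (adj , 2≤Cu) ,
    star⇒solvableWithin f steps′ (≤-pred (≤-trans (≤-reflexive (size-move {C = C} 2≤Cu (adj≢ adj))) size≤))
      (subst (_ ≤_) (D≗D′ o) t≤Do))

  solvable? : ∀ t C → Dec (Solvable m k o t C)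
  solvable? t C = map′ (solvableWithin⇒solvable (size C))
    (λ (_ , steps , t≤Do) → star⇒solvableWithin (size C) steps ≤-refl t≤Do)
    (solvableWithin? t (size C) C)

-- An isometric copy of P_{order}^{(k)} in P_n^{(k)} (for every k) whose root is sent to r.
record Side (n : ℕ) (r : Fin n) : Set where
  field
    order  : ℕ
    ι      : Fin order → Fin n
    root   : Fin order
    ι-root : ι root ≡ r
    ι-dist : ∀ a b → ∣ toℕ (ι a) - toℕ (ι b) ∣ ≡ ∣ toℕ a - toℕ b ∣
    image? : ∀ x → Dec (∃ λ y → ι y ≡ x)

open Side public using (order; ι; root; ι-root; image?)

module _ {n : ℕ} {r : Fin n} (S : Side n r) where

  Image : Fin n → Set
  Image x = ∃ λ y → ι S y ≡ x

  image-root : Image r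
  image-root = root S , ι-root S

  ι-injective : ∀ {a b} → ι S a ≡ ι S b → a ≡ b
  ι-injective {a} {b} ιa≡ιb = toℕ-injective (∣m-n∣≡0⇒m≡n
    (trans (sym (Side.ι-dist S a b)) (m≡n⇒∣m-n∣≡0 (cong toℕ ιa≡ιb))))

  ι-root-unique : ∀ {y} → ι S y ≡ r → y ≡ root S
  ι-root-unique ιy≡r = ι-injective (trans ιy≡r (sym (ι-root S)))

  adj-ι : ∀ {a b} → Adj (order S) k a b → Adj n k (ι S a) (ι S b)
  adj-ι {a = a} {b} = subst (λ d → 1 ≤ d × d ≤ _) (sym (Side.ι-dist S a b))

  adj-ι⁻ : ∀ {a b} → Adj n k (ι S a) (ι S b) → Adj (order S) k a b
  adj-ι⁻ {a = a} {b} = subst (λ d → 1 ≤ d × d ≤ _) (Side.ι-dist S a b)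

  pebble-ι : (a : Fin (order S)) → pebble (ι S a) ∘ ι S ≗ pebble a
  pebble-ι a y with y ≟ a
  ... | yes refl = trans (pebble-here (ι S a)) (sym (pebble-here a))
  ... | no y≢a = trans (pebble-elsewhere (y≢a ∘ ι-injective)) (sym (pebble-elsewhere y≢a))

  move-ι : (A : Config n) {a b : Fin (order S)} → a ≢ b → move A (ι S a) (ι S b) ∘ ι S ≗ move (A ∘ ι S) a b
  move-ι A a≢b = ≗move a≢b
    (move-source (a≢b ∘ ι-injective))
    (move-target (a≢b ∘ ι-injective))
    (λ y y≢a y≢b → move-other (y≢a ∘ ι-injective) (y≢b ∘ ι-injective))

  restrict-step : {A : Config n} {u w : Fin n} → Image u → Image w → Adj n k u w → 2 ≤ A u →
                  Step (order S) k (A ∘ ι S) (move A u w ∘ ι S)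
  restrict-step {A = A} (a , refl) (b , refl) adj 2≤Aa =
    step-resp (λ _ → refl) (λ y → sym (move-ι A (adj≢ (adj-ι⁻ adj)) y)) (step-move (adj-ι⁻ adj) 2≤Aa)

  lift : Config (order S) → Config n
  lift C x with image? S x
  ... | yes (y , _) = C y
  ... | no _ = 0

  lift-ι : (C : Config (order S)) (y : Fin (order S)) → lift C (ι S y) ≡ C y
  lift-ι C y with image? S (ι S y)
  ... | yes (y′ , ιy′≡ιy) = cong C (ι-injective ιy′≡ιy)
  ... | no ∉image = ⊥-elim (∉image (y , refl))

  lift-image : (C : Config (order S)) {a : Fin (order S)} {x : Fin n} → ι S a ≡ x → lift C x ≡ C a
  lift-image C {a} ιa≡x = trans (cong (lift C) (sym ιa≡x)) (lift-ι C a)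

  lift-outside : (C : Config (order S)) {x : Fin n} → ¬ Image x → lift C x ≡ 0
  lift-outside C {x} ∉image with image? S x
  ... | yes ∈image = ⊥-elim (∉image ∈image)
  ... | no _ = refl

  step-lift : {C D : Config (order S)} → Step (order S) k C D → Step n k (lift C) (lift D)
  step-lift {C = C} {D} (u , w , adj , 2≤Cu , Du+2≡Cu , Dw , Dx) =
    ι S u , ι S w , adj-ι adj , subst (2 ≤_) (sym (lift-ι C u)) 2≤Cu ,
    trans (cong (_+ 2) (lift-ι D u)) (trans Du+2≡Cu (sym (lift-ι C u))) ,
    trans (lift-ι D w) (trans Dw (cong suc (sym (lift-ι C w)))) , elsewhere
    where
    elsewhere : ∀ x → x ≢ ι S u → x ≢ ι S w → lift D x ≡ lift C x
    elsewhere x x≢u x≢w with image? S x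
    ... | yes (y , refl) = Dx y (x≢u ∘ cong (ι S)) (x≢w ∘ cong (ι S))
    ... | no _ = refl

  solvable-lift : {C : Config (order S)} → Solvable (order S) k (root S) t C → Solvable n k r t (lift C)
  solvable-lift {t = t} (D , steps , t≤Do) =
    lift D , gmap lift step-lift steps , subst (t ≤_) (trans (sym (lift-ι D (root S))) (cong (lift D) (ι-root S))) t≤Do

-- The invariant of the lower bound

-- D splits into a part on S that cannot put a + 1 pebbles on r and a part on T that cannot put
-- b + 1; this survives every pebbling step (capped-star), so r never holds more than a + b.
record Capped {n : ℕ} {r : Fin n} (k : ℕ) (S T : Side n r) (D : Config n) (s : ℕ) : Set where
  field
    A B      : Config n
    a b      : ℕ
    split    : D ≗ A ⊕ B
    A-on-S   : ∀ {x} → ¬ Image S x → A x ≡ 0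
    B-on-T   : ∀ {x} → ¬ Image T x → B x ≡ 0
    a+b≡s    : a + b ≡ s
    A-capped : ¬ Solvable (order S) k (root S) (suc a) (A ∘ ι S)
    B-capped : ¬ Solvable (order T) k (root T) (suc b) (B ∘ ι T)

module _ {n : ℕ} {r : Fin n} {S T : Side n r} {s : ℕ} where

  capped-swap : {D : Config n} → Capped k S T D s → Capped k T S D s
  capped-swap c = record
    { A = B ; B = A ; a = b ; b = a ; split = λ x → trans (split x) (+-comm (A x) (B x))
    ; A-on-S = B-on-T ; B-on-T = A-on-S ; a+b≡s = trans (+-comm b a) a+b≡s
    ; A-capped = B-capped ; B-capped = A-capped }
    where open Capped c

  capped-root : {D : Config n} → Capped k S T D s → D r ≤ s
  capped-root {D = D} c = begin
    D r       ≡⟨ split r ⟩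
    A r + B r ≤⟨ +-mono-≤ (root≤ S {A} A-capped) (root≤ T {B} B-capped) ⟩
    a + b     ≡⟨ a+b≡s ⟩
    s         ∎
    where
    open Capped c
    open ≤-Reasoning
    root≤ : (U : Side n r) {E : Config n} {e : ℕ} →
            ¬ Solvable (order U) k (root U) (suc e) (E ∘ ι U) → E r ≤ e
    root≤ U {E} unsolvable = subst (_≤ _) (cong E (ι-root U)) (unsolvable⇒root≤ unsolvable)

  capped-resp : {D D′ : Config n} → D ≗ D′ → Capped k S T D s → Capped k S T D′ s
  capped-resp D≗D′ c = record
    { A = A ; B = B ; a = a ; b = b ; split = λ x → trans (sym (D≗D′ x)) (split x)
    ; A-on-S = A-on-S ; B-on-T = B-on-T ; a+b≡s = a+b≡s ; A-capped = A-capped ; B-capped = B-capped }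
    where open Capped c

  capped-A≥2 : {D : Config n} (c : Capped k S T D s) {u : Fin n} → Capped.B c u ≡ 0 → 2 ≤ D u → 2 ≤ Capped.A c u
  capped-A≥2 c {u} Bu≡0 = subst (2 ≤_) (trans (split u) (trans (cong (A u +_) Bu≡0) (+-identityʳ (A u))))
    where open Capped c

  capped-inner : {D : Config n} (c : Capped k S T D s) {u w : Fin n} → Image S u → Image S w →
                 Adj n k u w → 2 ≤ Capped.A c u → Capped k S T (move D u w) s
  capped-inner c {u} {w} u∈S w∈S adj 2≤Au = record
    { A = move A u w ; B = B ; a = a ; b = b
    ; split = λ x → trans (move-cong u≢w split x) (sym (move-⊕ u≢w 2≤Au x))
    ; A-on-S = λ x∉S → trans (move-other {C = A} (λ { refl → x∉S u∈S }) (λ { refl → x∉S w∈S })) (A-on-S x∉S)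
    ; B-on-T = B-on-T ; a+b≡s = a+b≡s
    ; A-capped = A-capped ∘ solvable-step (restrict-step S u∈S w∈S adj 2≤Au) ; B-capped = B-capped }
    where
    open Capped c
    u≢w : u ≢ w
    u≢w = adj≢ adj

  -- Losing a pebble at r costs A exactly one unit of reach; an extra pebble gains B at most one.
  capped-transfer : {D : Config n} (c : Capped k S T D s) {w : Fin n} → 1 ≤ Capped.A c r → Image T w →
                    Capped k S T ((D ⊖ pebble r) ⊕ pebble w) s
  capped-transfer {k = k} {D = D} c {w} 1≤Ar (w′ , ιw′≡w) = record
    { A = A ⊖ pebble r ; B = B ⊕ pebble w ; a = a ∸ 1 ; b = suc b
    ; split = split′
    ; A-on-S = λ {x} x∉S → trans (cong (_∸ pebble r x) (A-on-S x∉S)) (0∸n≡0 (pebble r x))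
    ; B-on-T = λ {x} x∉T →
        cong₂ _+_ (B-on-T x∉T) (pebble-elsewhere {v = w} λ { refl → x∉T (w′ , ιw′≡w) })
    ; a+b≡s = trans (+-suc (a ∸ 1) b) (trans (cong (_+ b) a-1+1≡a) a+b≡s)
    ; A-capped = A-capped′ ; B-capped = B-capped′ }
    where
    open Capped c
    1≤a : 1 ≤ a
    1≤a = ≤-trans 1≤Ar (subst (_≤ a) (cong A (ι-root S)) (unsolvable⇒root≤ A-capped))
    a-1+1≡a : suc (a ∸ 1) ≡ a
    a-1+1≡a = trans (+-comm 1 (a ∸ 1)) (m∸n+n≡m 1≤a)
    split′ : (D ⊖ pebble r) ⊕ pebble w ≗ (A ⊖ pebble r) ⊕ (B ⊕ pebble w)
    split′ x = begin
      D x ∸ pebble r x + pebble w x         ≡⟨ cong (λ d → d ∸ pebble r x + pebble w x) (split x) ⟩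
      A x + B x ∸ pebble r x + pebble w x   ≡⟨ cong (_+ pebble w x) (+-∸-comm (B x) (pebble≤ 1≤Ar x)) ⟩
      A x ∸ pebble r x + B x + pebble w x   ≡⟨ +-assoc (A x ∸ pebble r x) (B x) (pebble w x) ⟩
      A x ∸ pebble r x + (B x + pebble w x) ∎
      where open ≡-Reasoning
    A-capped′ : ¬ Solvable (order S) k (root S) (suc (a ∸ 1)) ((A ⊖ pebble r) ∘ ι S)
    A-capped′ solvable = A-capped (subst (λ e → Solvable (order S) k (root S) e (A ∘ ι S)) (cong suc a-1+1≡a)
      (solvable-resp restored (solvable-root solvable)))
      where
      restored : (A ⊖ pebble r) ∘ ι S ⊕ pebble (root S) ≗ A ∘ ι S
      restored y = trans (cong ((A ⊖ pebble r) (ι S y) +_)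
                                (trans (sym (pebble-ι S (root S) y)) (cong (λ v → pebble v (ι S y)) (ι-root S))))
                         (⊖-pebble-⊕ {C = A} 1≤Ar (ι S y))
    B-capped′ : ¬ Solvable (order T) k (root T) (suc (suc b)) ((B ⊕ pebble w) ∘ ι T)
    B-capped′ = B-capped ∘ solvable-unpebble ∘ solvable-resp λ y →
      cong (B (ι T y) +_) (trans (cong (λ v → pebble v (ι T y)) (sym ιw′≡w)) (pebble-ι T w′ y))

capped-shift : {n : ℕ} {r : Fin n} {S T : Side n r} {D : Config n} {s : ℕ} →
               Capped k S T D s → Σ (Capped k S T D s) λ c → Capped.B c r ≡ 0
capped-shift {k = k} {r = r} {S} {T} {s = s} c = go _ c refl
  where
  go : ∀ {D} j (c : Capped k S T D s) → Capped.B c r ≡ j → Σ (Capped k S T D s) λ c′ → Capped.B c′ r ≡ 0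
  go zero c Br≡0 = c , Br≡0
  go {D} (suc j) c Br≡1+j = go j (capped-swap (capped-resp restored moved)) 
    (trans (cong (B r ∸_) (pebble-here r)) (cong (_∸ 1) Br≡1+j))
    where
    open Capped c
    1≤Br : 1 ≤ B r
    1≤Br = subst (1 ≤_) (sym Br≡1+j) (s≤s z≤n)
    moved : Capped k T S ((D ⊖ pebble r) ⊕ pebble r) s
    moved = capped-transfer (capped-swap c) 1≤Br (image-root S)
    restored : (D ⊖ pebble r) ⊕ pebble r ≗ D
    restored = ⊖-pebble-⊕ (subst (1 ≤_) (sym (split r)) (≤-trans 1≤Br (m≤n+m (B r) (A r))))

capped-lift : {n : ℕ} {r : Fin n} {S T : Side n r} {C₁ : Config (order S)} {C₂ : Config (order T)} {a b : ℕ} →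
              ¬ Solvable (order S) k (root S) (suc a) C₁ → ¬ Solvable (order T) k (root T) (suc b) C₂ →
              Capped k S T (lift S C₁ ⊕ lift T C₂) (a + b)
capped-lift {S = S} {T} {C₁} {C₂} unsolvable₁ unsolvable₂ = record
  { A = lift S C₁ ; B = lift T C₂ ; a = _ ; b = _ ; split = λ _ → refl
  ; A-on-S = lift-outside S C₁ ; B-on-T = lift-outside T C₂ ; a+b≡s = refl
  ; A-capped = unsolvable₁ ∘ solvable-resp (lift-ι S C₁)
  ; B-capped = unsolvable₂ ∘ solvable-resp (lift-ι T C₂) }

-- Gluing two sides at r

record Gluing (n k : ℕ) (r : Fin n) : Set where
  field
    S T        : Side n r
    S∩T⊆r    : ∀ {x} → Image S x → Image T x → x ≡ r
    S-or-T     : ∀ {x} → ¬ Image S x → Image T x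
    shortcut-S : ∀ {u w} → Image S u → u ≢ r → Image T w → Adj n k u w → Adj n k u r
    shortcut-T : ∀ {u w} → Image T u → u ≢ r → Image S w → Adj n k u w → Adj n k u r
    size-glue  : ∀ C → size C + C r ≡ size (C ∘ ι S) + size (C ∘ ι T)

  T-or-S : ∀ {x} → ¬ Image T x → Image S x
  T-or-S {x} x∉T with image? S x
  ... | yes x∈S = x∈S
  ... | no x∉S = ⊥-elim (x∉T (S-or-T x∉S))

swap : {n k : ℕ} {r : Fin n} → Gluing n k r → Gluing n k r
swap G = record
  { S = T ; T = S ; S∩T⊆r = λ x∈T x∈S → S∩T⊆r x∈S x∈T ; S-or-T = T-or-S
  ; shortcut-S = shortcut-T ; shortcut-T = shortcut-S
  ; size-glue = λ C → trans (size-glue C) (+-comm (size (C ∘ ι S)) _) }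
  where open Gluing G

module _ {n k : ℕ} {r : Fin n} where

  capped-within : (G : Gluing n k r) → let open Gluing G in
                  {D : Config n} {s : ℕ} {u w : Fin n} → Capped k S T D s →
                  Image S u → Image S w → Adj n k u w → 2 ≤ D u → Capped k S T (move D u w) s
  capped-within G {D} {u = u} c u∈S w∈S adj 2≤Du with u ≟ r
  ... | yes refl =
    let c′ , B′r≡0 = capped-shift c in capped-inner c′ u∈S w∈S adj (capped-A≥2 c′ B′r≡0 2≤Du)
    where open Gluing G
  ... | no u≢r =
    capped-inner c u∈S w∈S adj (capped-A≥2 c (Capped.B-on-T c λ u∈T → u≢r (S∩T⊆r u∈S u∈T)) 2≤Du)
    where open Gluing G

  capped-cross : (G : Gluing n k r) → let open Gluing G in
                 {D : Config n} {s : ℕ} {u w : Fin n} → Capped k S T D s →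
                 Image S u → u ≢ r → Image T w → w ≢ r → Adj n k u w → 2 ≤ D u → Capped k S T (move D u w) s
  capped-cross G {D} {s} {u} {w} c u∈S u≢r w∈T w≢r adj 2≤Du =
    capped-resp (move-reroute u≢r w≢r (adj≢ adj)) (capped-transfer via-r 1≤Ar w∈T)
    where
    open Gluing G
    via-r : Capped k S T (move D u r) s
    via-r = capped-inner c u∈S (image-root S) (shortcut-S u∈S u≢r w∈T adj)
              (capped-A≥2 c (Capped.B-on-T c λ u∈T → u≢r (S∩T⊆r u∈S u∈T)) 2≤Du)
    1≤Ar : 1 ≤ Capped.A via-r r
    1≤Ar = subst (1 ≤_) (sym (move-target {C = Capped.A c} u≢r)) (s≤s z≤n)

  capped-move-from-S : (G : Gluing n k r) → let open Gluing G in
                       {D : Config n} {s : ℕ} {u w : Fin n} → Capped k S T D s →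
                       Image S u → Adj n k u w → 2 ≤ D u → Capped k S T (move D u w) s
  capped-move-from-S G {u = u} {w} c u∈S adj 2≤Du with image? (Gluing.S G) w | u ≟ r
  ... | yes w∈S | _ = capped-within G c u∈S w∈S adj 2≤Du
  ... | no w∉S | yes refl =
    capped-swap (capped-within (swap G) (capped-swap c) (image-root T) (S-or-T w∉S) adj 2≤Du)
    where open Gluing G
  ... | no w∉S | no u≢r = capped-cross G c u∈S u≢r (S-or-T w∉S) (λ { refl → w∉S (image-root S) }) adj 2≤Du
    where open Gluing G

  capped-step : (G : Gluing n k r) → let open Gluing G in
                {D D′ : Config n} {s : ℕ} → Capped k S T D s → Step n k D D′ → Capped k S T D′ s
  capped-step G c step@(u , w , adj , 2≤Du , _) = capped-resp (λ x → sym (step≗move step x)) moved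
    where
    open Gluing G
    moved : Capped k S T (move _ u w) _
    moved with image? S u
    ... | yes u∈S = capped-move-from-S G c u∈S adj 2≤Du
    ... | no u∉S = capped-swap (capped-move-from-S (swap G) (capped-swap c) (S-or-T u∉S) adj 2≤Du)

  capped-star : (G : Gluing n k r) → let open Gluing G in
                {D D′ : Config n} {s : ℕ} → Capped k S T D s → Star (Step n k) D D′ → Capped k S T D′ s
  capped-star G c ε = c
  capped-star G c (step ◅ steps) = capped-star G (capped-step G c step) steps

  capped⇒unsolvable : (G : Gluing n k r) → let open Gluing G in
                      {D : Config n} {s : ℕ} → Capped k S T D s → ¬ Solvable n k r (suc s) D
  capped⇒unsolvable G c (_ , steps , s<Dr) = <⇒≱ s<Dr (capped-root (capped-star G c steps))

module _ {n k : ℕ} {r : Fin n} (G : Gluing n k r) where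
  open Gluing G

  -- r is counted on the S side only.
  restrict⁰ : Config n → Config (order T)
  restrict⁰ C = updateAt (C ∘ ι T) (root T) (const 0)

  size-restrict : (C : Config n) → size (C ∘ ι S) + size (restrict⁰ C) ≡ size C
  size-restrict C = +-cancelʳ-≡ (C r) _ _ (begin
    size (C ∘ ι S) + size (restrict⁰ C) + C r   ≡⟨ +-assoc (size (C ∘ ι S)) _ _ ⟩
    size (C ∘ ι S) + (size (restrict⁰ C) + C r) ≡⟨ cong (size (C ∘ ι S) +_) restricted ⟩
    size (C ∘ ι S) + size (C ∘ ι T)             ≡⟨ size-glue C ⟨
    size C + C r                                ∎)
    where
    open ≡-Reasoning
    restricted : size (restrict⁰ C) + C r ≡ size (C ∘ ι T)
    restricted = trans (cong (λ x → size (restrict⁰ C) + C x) (sym (ι-root T)))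
      (trans (size-updateAt (C ∘ ι T) (root T) (const 0)) (+-identityʳ _))

  restrict-split : (C : Config n) → C ≗ lift S (C ∘ ι S) ⊕ lift T (restrict⁰ C)
  restrict-split C x = sym (by-S (image? S x))
    where
    open ≡-Reasoning
    R = restrict⁰ C
    by-T : Image S x → Dec (Image T x) → lift T R x ≡ 0
    by-T _ (no x∉T) = lift-outside T R x∉T
    by-T x∈S (yes x∈T@(b , ιb≡x)) = begin
      lift T R x     ≡⟨ lift-image T R ιb≡x ⟩
      R b            ≡⟨ cong R (ι-root-unique T (trans ιb≡x (S∩T⊆r x∈S x∈T))) ⟩
      R (root T)     ≡⟨ updateAt-updates (root T) (C ∘ ι T) ⟩
      0              ∎
    outside-S : ¬ Image S x → Image T x → lift S (C ∘ ι S) x + lift T R x ≡ C x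
    outside-S x∉S (b , ιb≡x) = begin
      lift S (C ∘ ι S) x + lift T R x ≡⟨ cong₂ _+_ (lift-outside S (C ∘ ι S) x∉S) (lift-image T R ιb≡x) ⟩
      R b                             ≡⟨ updateAt-minimal b (root T) (C ∘ ι T) b≢root ⟩
      C (ι T b)                       ≡⟨ cong C ιb≡x ⟩
      C x                             ∎
      where
      b≢root : b ≢ root T
      b≢root refl = x∉S (subst (Image S) (trans (sym (ι-root T)) ιb≡x) (image-root S))
    by-S : Dec (Image S x) → lift S (C ∘ ι S) x + lift T R x ≡ C x
    by-S (yes x∈S@(a , ιa≡x)) = begin
      lift S (C ∘ ι S) x + lift T R x ≡⟨ cong₂ _+_ (lift-image S (C ∘ ι S) ιa≡x) (by-T x∈S (image? T x)) ⟩
      C (ι S a) + 0                   ≡⟨ +-identityʳ _ ⟩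
      C (ι S a)                       ≡⟨ cong C ιa≡x ⟩
      C x                             ∎
    by-S (no x∉S) = outside-S x∉S (S-or-T x∉S)

  solvable-glue : {C : Config n} {j j′ : ℕ} → Solvable (order S) k (root S) j (C ∘ ι S) →
                  Solvable (order T) k (root T) j′ (restrict⁰ C) → Solvable n k r (j + j′) C
  solvable-glue {C} solvable₁ solvable₂ = solvable-resp (λ x → sym (restrict-split C x))
    (solvable-⊕ (solvable-lift S solvable₁) (solvable-lift T solvable₂))

  size-lift : (C₁ : Config (order S)) → size (lift S C₁) ≡ size C₁
  size-lift C₁ = +-cancelʳ-≡ (L r) _ _ (begin
    size L + L r                     ≡⟨ size-glue L ⟩
    size (L ∘ ι S) + size (L ∘ ι T)  ≡⟨ cong₂ _+_ (size-cong (lift-ι S C₁)) (size-concentrated (root T) off-root) ⟩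
    size C₁ + L (ι T (root T))       ≡⟨ cong (λ x → size C₁ + L x) (ι-root T) ⟩
    size C₁ + L r                    ∎)
    where
    open ≡-Reasoning
    L = lift S C₁
    off-root : ∀ y → y ≢ root T → L (ι T y) ≡ 0
    off-root y y≢root = lift-outside S C₁ λ ιy∈S → y≢root (ι-root-unique T (S∩T⊆r ιy∈S (y , refl)))

size-lifts : {n k : ℕ} {r : Fin n} (G : Gluing n k r) → let open Gluing G in
             (C₁ : Config (order S)) (C₂ : Config (order T)) → size (lift S C₁ ⊕ lift T C₂) ≡ size C₁ + size C₂
size-lifts G C₁ C₂ = trans (size-⊕ (lift S C₁) (lift T C₂)) (cong₂ _+_ (size-lift G C₁) (size-lift (swap G) C₂))
  where open Gluing G

≤-foldr-⊔ : {x : ℕ} {xs : List ℕ} → Any (x ≤_) xs → x ≤ foldr _⊔_ 0 xs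
≤-foldr-⊔ (here x≤y) = ≤-trans x≤y (m≤m⊔n _ _)
≤-foldr-⊔ (there x≤ys) = ≤-trans (≤-foldr-⊔ x≤ys) (m≤n⊔m _ _)

<-foldr-⊔ : {x : ℕ} (xs : List ℕ) → x < foldr _⊔_ 0 xs → Any (x <_) xs
<-foldr-⊔ (y ∷ ys) x<max with ⊔-sel y (foldr _⊔_ 0 ys)
... | inj₁ max≡y = here (subst (_ <_) max≡y x<max)
... | inj₂ max≡ys = there (<-foldr-⊔ ys (subst (_ <_) max≡ys x<max))

maxSplit-≥ : (f g : ℕ → ℕ) {t j : ℕ} → j < t → f (suc j) + g (t ∸ j) ∸ 1 ≤ maxSplit f g t
maxSplit-≥ f g j<t = ≤-foldr-⊔ (Any.map⁺ (Any.applyUpTo⁺ suc ≤-refl j<t))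

maxSplit-> : (f g : ℕ → ℕ) {t x : ℕ} → x < maxSplit f g t → ∃[ j ] j < t × x < f (suc j) + g (t ∸ j) ∸ 1
maxSplit-> f g {t} x<max = Any.applyUpTo⁻ suc (Any.map⁻ (<-foldr-⊔ _ x<max))

empty-unsolvable : {o : Fin m} → 1 ≤ t → ¬ Solvable m k o t (const 0)
empty-unsolvable 1≤t (_ , ε , t≤0) = <⇒≱ 1≤t t≤0
empty-unsolvable 1≤t (_ , (_ , _ , _ , () , _) ◅ _ , _)

pebblingNumber-pos : {o : Fin m} {p : ℕ} → 1 ≤ t → IsPebblingNumber m k o t p → ∃[ a ] p ≡ suc a
pebblingNumber-pos {m = m} {p = zero} 1≤t (all , _) =
  ⊥-elim (empty-unsolvable 1≤t (all (const 0) (size-zero {m} λ _ → refl)))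
pebblingNumber-pos {p = suc a} _ _ = a , refl

-- Configurations cannot be searched, so minimality only yields an unsolvable configuration of a
-- pebbles in this double-negated form, and even that needs solvability to be decidable.
pebblingNumber-critical : {o : Fin m} {a : ℕ} → IsPebblingNumber m k o t (suc a) →
                          ¬ ((C : Config m) → size C ≡ a → ¬ ¬ Solvable m k o t C)
pebblingNumber-critical {t = t} (_ , minimal) ¬¬solvable = minimal _ ≤-refl λ C size-C →
  decidable-stable (solvable? t C) (¬¬solvable C size-C)

module _ {n k : ℕ} {r : Fin n} (G : Gluing n k r) (p₁ p₂ : ℕ → ℕ) where
  open Gluing G

  gluing-upper : (∀ t₁ → 1 ≤ t₁ → AllSolvable (order S) k (root S) t₁ (p₁ t₁)) →
                 (∀ t₂ → 1 ≤ t₂ → AllSolvable (order T) k (root T) t₂ (p₂ t₂)) →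
                 ∀ t → AllSolvable n k r t (maxSplit p₁ p₂ t)
  gluing-upper all₁ all₂ t C size-C = climb t 0 refl solvable-zero
    where
    c₁ = size (C ∘ ι S)
    c₂ = size (restrict⁰ G C)
    remaining : ∀ {p q} → c₁ < p → p + q ∸ 1 ≤ c₁ + c₂ → q ≤ c₂
    remaining {p} {q} c₁<p p+q-1≤ = +-cancelˡ-≤ c₁ q c₂ (begin
      c₁ + q      ≤⟨ +-monoˡ-≤ q (∸-monoˡ-≤ 1 c₁<p) ⟩
      p ∸ 1 + q   ≡⟨ +-∸-comm q (≤-trans (s≤s z≤n) c₁<p) ⟨
      p + q ∸ 1   ≤⟨ p+q-1≤ ⟩
      c₁ + c₂     ∎)
      where open ≤-Reasoning
    -- Raise the target j on S while S holds p₁ (j + 1) pebbles; once it does not, maxSplit leaves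
    -- p₂ (t - j) pebbles on T.
    climb : ∀ d j → j + d ≡ t → Solvable (order S) k (root S) j (C ∘ ι S) → Solvable n k r t C
    climb zero j j+0≡t solvable₁ = subst (λ e → Solvable n k r e C) j+0≡t (solvable-glue G solvable₁ solvable-zero)
    climb (suc d) j j+d+1≡t solvable₁ with p₁ (suc j) ≤? c₁
    ... | yes p₁≤c₁ = climb d (suc j) (trans (sym (+-suc j d)) j+d+1≡t)
                        (allSolvable-≥ (all₁ (suc j) (s≤s z≤n)) (C ∘ ι S) p₁≤c₁)
    ... | no p₁≰c₁ = subst (λ e → Solvable n k r e C) j+d+1≡t
                       (solvable-glue G solvable₁
                         (allSolvable-≥ (all₂ (suc d) (s≤s z≤n)) (restrict⁰ G C) p₂≤c₂))
      where
      open ≤-Reasoning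
      j<t : j < t
      j<t = subst (j <_) j+d+1≡t (m<m+n j (s≤s z≤n))
      t-j≡1+d : t ∸ j ≡ suc d
      t-j≡1+d = trans (cong (_∸ j) (sym j+d+1≡t)) (m+n∸m≡n j (suc d))
      p₂≤c₂ : p₂ (suc d) ≤ c₂
      p₂≤c₂ = remaining (≰⇒> p₁≰c₁) (begin
        p₁ (suc j) + p₂ (suc d) ∸ 1 ≡⟨ cong (λ e → p₁ (suc j) + p₂ e ∸ 1) t-j≡1+d ⟨
        p₁ (suc j) + p₂ (t ∸ j) ∸ 1 ≤⟨ maxSplit-≥ p₁ p₂ j<t ⟩
        maxSplit p₁ p₂ t            ≡⟨ size-C ⟨
        size C                      ≡⟨ size-restrict G C ⟨
        c₁ + c₂                     ∎)

  gluing-lower : (∀ t₁ → 1 ≤ t₁ → IsPebblingNumber (order S) k (root S) t₁ (p₁ t₁)) →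
                 (∀ t₂ → 1 ≤ t₂ → IsPebblingNumber (order T) k (root T) t₂ (p₂ t₂)) →
                 ∀ t {m′} → m′ < maxSplit p₁ p₂ t → ¬ AllSolvable n k r t m′
  gluing-lower π₁ π₂ t {m′} m′<max all =
    let j , j<t , m′<p₁+p₂-1 = maxSplit-> p₁ p₂ m′<max in refute j j<t m′<p₁+p₂-1
    where
    refute : ∀ j → j < t → m′ < p₁ (suc j) + p₂ (t ∸ j) ∸ 1 → ⊥
    refute j j<t m′<p₁+p₂-1
      with pebblingNumber-pos (s≤s z≤n) (π₁ (suc j) (s≤s z≤n)) | pebblingNumber-pos 1≤t-j (π₂ (t ∸ j) 1≤t-j)
      where 1≤t-j = m<n⇒0<n∸m j<t
    ... | a₁ , p₁≡1+a₁ | b₁ , p₂≡1+b₁ =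
      pebblingNumber-critical (subst (IsPebblingNumber _ k _ (suc j)) p₁≡1+a₁ (π₁ (suc j) (s≤s z≤n)))
        λ C₁ size-C₁ unsolvable₁ →
      pebblingNumber-critical (subst (IsPebblingNumber _ k _ (t ∸ j)) p₂≡1+b₁ (π₂ (t ∸ j) (m<n⇒0<n∸m j<t)))
        λ C₂ size-C₂ unsolvable₂ →
      capped⇒unsolvable G
        (capped-lift unsolvable₁ (unsolvable₂ ∘ subst (λ e → Solvable (order T) k (root T) e C₂) t-j≡))
        (subst (λ e → Solvable n k r e _) (sym j+[t-j-1]+1≡t)
          (allSolvable-≥ all _ (m′≤size size-C₁ size-C₂)))
      where
      t-j≡ : suc (t ∸ suc j) ≡ t ∸ j
      t-j≡ = sym (+-∸-assoc 1 j<t)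
      j+[t-j-1]+1≡t : suc (j + (t ∸ suc j)) ≡ t
      j+[t-j-1]+1≡t = trans (sym (+-suc j _)) (trans (cong (j +_) t-j≡) (m+[n∸m]≡n (<⇒≤ j<t)))
      m′≤a₁+b₁ : m′ ≤ a₁ + b₁
      m′≤a₁+b₁ = ≤-pred (≤-trans (subst₂ (λ x y → m′ < x + y ∸ 1) p₁≡1+a₁ p₂≡1+b₁ m′<p₁+p₂-1)
                                   (≤-reflexive (+-suc a₁ b₁)))
      m′≤size : {C₁ : Config (order S)} {C₂ : Config (order T)} →
                size C₁ ≡ a₁ → size C₂ ≡ b₁ → m′ ≤ size (lift S C₁ ⊕ lift T C₂)
      m′≤size {C₁} {C₂} size-C₁ size-C₂ =
        ≤-trans m′≤a₁+b₁ (≤-reflexive (sym (trans (size-lifts G C₁ C₂) (cong₂ _+_ size-C₁ size-C₂))))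

  gluing-pebblingNumber : (∀ t₁ → 1 ≤ t₁ → IsPebblingNumber (order S) k (root S) t₁ (p₁ t₁)) →
                          (∀ t₂ → 1 ≤ t₂ → IsPebblingNumber (order T) k (root T) t₂ (p₂ t₂)) →
                          ∀ t → IsPebblingNumber n k r t (maxSplit p₁ p₂ t)
  gluing-pebblingNumber π₁ π₂ t =
    gluing-upper (λ t₁ 1≤t₁ → proj₁ (π₁ t₁ 1≤t₁)) (λ t₂ 1≤t₂ → proj₁ (π₂ t₂ 1≤t₂)) t ,
    λ _ m′<max → gluing-lower π₁ π₂ t m′<max

-- P_n^{(k)} as a gluing at an interior vertex

between : {a b c : ℕ} → a ≤ b → b ≤ c → ∣ a - b ∣ ≤ ∣ a - c ∣ × ∣ c - b ∣ ≤ ∣ c - a ∣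
between {a} {b} {c} a≤b b≤c =
  subst₂ _≤_ (sym (m≤n⇒∣m-n∣≡n∸m a≤b)) (sym (m≤n⇒∣m-n∣≡n∸m a≤c)) (∸-monoˡ-≤ a b≤c) ,
  subst₂ _≤_ (sym (m≤n⇒∣n-m∣≡n∸m b≤c)) (sym (m≤n⇒∣n-m∣≡n∸m a≤c)) (∸-monoʳ-≤ c a≤b)
  where
  a≤c = ≤-trans a≤b b≤c

adj-shortcut : {n k : ℕ} {u w r : Fin n} → Adj n k u w → u ≢ r →
               ∣ toℕ u - toℕ r ∣ ≤ ∣ toℕ u - toℕ w ∣ → Adj n k u r
adj-shortcut (_ , ≤k) u≢r closer =
  n≢0⇒n>0 (u≢r ∘ toℕ-injective ∘ ∣m-n∣≡0⇒m≡n) , ≤-trans closer ≤k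

module _ {n k : ℕ} (r : Fin n) (r<n-1 : suc (toℕ r) < n) where
  private
    ρ n₂ : ℕ
    ρ = toℕ r
    n₂ = suc (n ∸ suc ρ)
    ρ+n₂≡n : ρ + n₂ ≡ n
    ρ+n₂≡n = trans (+-suc ρ _) (m+[n∸m]≡n (<⇒≤ r<n-1))

  ι₁ : Fin (suc ρ) → Fin n
  ι₁ y = inject≤ y (<⇒≤ r<n-1)

  ι₂ : Fin n₂ → Fin n
  ι₂ y = cast ρ+n₂≡n (ρ ↑ʳ y)

  toℕ-ι₁ : ∀ y → toℕ (ι₁ y) ≡ toℕ y
  toℕ-ι₁ y = toℕ-inject≤ y (<⇒≤ r<n-1)

  toℕ-ι₂ : ∀ y → toℕ (ι₂ y) ≡ ρ + toℕ y
  toℕ-ι₂ y = trans (toℕ-cast ρ+n₂≡n (ρ ↑ʳ y)) (toℕ-↑ʳ ρ y)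

  image₁ : ∀ {x} → toℕ x ≤ ρ → ∃ λ y → ι₁ y ≡ x
  image₁ x≤ρ = fromℕ< (s≤s x≤ρ) , toℕ-injective (trans (toℕ-ι₁ _) (toℕ-fromℕ< (s≤s x≤ρ)))

  image₁⁻ : ∀ {x} → (∃ λ y → ι₁ y ≡ x) → toℕ x ≤ ρ
  image₁⁻ (y , refl) = subst (_≤ ρ) (sym (toℕ-ι₁ y)) (≤-pred (toℕ<n y))

  image₂ : ∀ {x} → ρ ≤ toℕ x → ∃ λ y → ι₂ y ≡ x
  image₂ {x} ρ≤x = fromℕ< x-ρ<n₂ , toℕ-injective (begin
    toℕ (ι₂ (fromℕ< x-ρ<n₂)) ≡⟨ toℕ-ι₂ _ ⟩
    ρ + toℕ (fromℕ< x-ρ<n₂)  ≡⟨ cong (ρ +_) (toℕ-fromℕ< x-ρ<n₂) ⟩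
    ρ + (toℕ x ∸ ρ)          ≡⟨ m+[n∸m]≡n ρ≤x ⟩
    toℕ x                    ∎)
    where
    open ≡-Reasoning
    x-ρ<n₂ : toℕ x ∸ ρ < n₂
    x-ρ<n₂ = s≤s (∸-monoˡ-≤ (suc ρ) (toℕ<n x))

  image₂⁻ : ∀ {x} → (∃ λ y → ι₂ y ≡ x) → ρ ≤ toℕ x
  image₂⁻ (y , refl) = subst (ρ ≤_) (sym (toℕ-ι₂ y)) (m≤m+n ρ (toℕ y))

  -- left is v_1 … v_i and right is v_i … v_n, where r = v_i.
  left : Side n r
  left = record
    { order = suc ρ ; ι = ι₁ ; root = fromℕ ρ
    ; ι-root = toℕ-injective (trans (toℕ-ι₁ (fromℕ ρ)) (toℕ-fromℕ ρ))
    ; ι-dist = λ a b → cong₂ ∣_-_∣ (toℕ-ι₁ a) (toℕ-ι₁ b)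
    ; image? = λ x → map′ image₁ image₁⁻ (toℕ x ≤? ρ) }

  right : Side n r
  right = record
    { order = n₂ ; ι = ι₂ ; root = zero
    ; ι-root = toℕ-injective (trans (toℕ-ι₂ zero) (+-identityʳ ρ))
    ; ι-dist = λ a b → trans (cong₂ ∣_-_∣ (toℕ-ι₂ a) (toℕ-ι₂ b)) (∣m+n-m+o∣≡∣n-o∣ ρ (toℕ a) (toℕ b))
    ; image? = λ x → map′ image₂ image₂⁻ (ρ ≤? toℕ x) }

  size-left-right : (C : Config n) → size C + C r ≡ size (C ∘ ι₁) + size (C ∘ ι₂)
  size-left-right C = begin
    size C + C r                                 ≡⟨ cong (_+ C r) (size-cast ρ+n₂≡n C) ⟨
    size C′ + C r                                ≡⟨ cong (_+ C r) (size-↑ ρ n₂ C′) ⟩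
    size (C′ ∘ (_↑ˡ n₂)) + size (C ∘ ι₂) + C r   ≡⟨ +-right-comm (size (C′ ∘ (_↑ˡ n₂))) _ (C r) ⟩
    size (C′ ∘ (_↑ˡ n₂)) + C r + size (C ∘ ι₂)   ≡⟨ cong (_+ size (C ∘ ι₂)) left-part ⟨
    size (C ∘ ι₁) + size (C ∘ ι₂)                ∎
    where
    open ≡-Reasoning
    C′ : Config (ρ + n₂)
    C′ = C ∘ cast ρ+n₂≡n
    +-right-comm : ∀ a b c → a + b + c ≡ a + c + b
    +-right-comm = solve-∀
    prefix : C ∘ ι₁ ∘ inject₁ ≗ C′ ∘ (_↑ˡ n₂)
    prefix y = cong C (toℕ-injective (begin
      toℕ (ι₁ (inject₁ y))          ≡⟨ trans (toℕ-ι₁ _) (toℕ-inject₁ y) ⟩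
      toℕ y                         ≡⟨ trans (toℕ-cast ρ+n₂≡n _) (toℕ-↑ˡ y n₂) ⟨
      toℕ (cast ρ+n₂≡n (y ↑ˡ n₂))   ∎))
    left-part : size (C ∘ ι₁) ≡ size (C′ ∘ (_↑ˡ n₂)) + C r
    left-part = trans (size-inject₁ (C ∘ ι₁)) (cong₂ _+_ (size-cong prefix) (cong C (Side.ι-root left)))

  interior : Gluing n k r
  interior = record
    { S = left ; T = right
    ; S∩T⊆r = λ x∈S x∈T → toℕ-injective (≤-antisym (image₁⁻ x∈S) (image₂⁻ x∈T))
    ; S-or-T = λ x∉S → image₂ (<⇒≤ (≰⇒> (x∉S ∘ image₁)))
    ; shortcut-S = λ u∈S u≢r w∈T adj →
        adj-shortcut adj u≢r (proj₁ (between (image₁⁻ u∈S) (image₂⁻ w∈T)))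
    ; shortcut-T = λ u∈T u≢r w∈S adj →
        adj-shortcut adj u≢r (proj₂ (between (image₁⁻ w∈S) (image₂⁻ u∈T)))
    ; size-glue = size-left-right }

corollary18 : (n k : ℕ) → 1 ≤ k → suc k < n →
    (r : Fin n) → 0 < toℕ r → suc (toℕ r) < n →
    (p₁ p₂ : ℕ → ℕ) →
    ((t₁ : ℕ) → 1 ≤ t₁ → IsPebblingNumber (suc (toℕ r)) k (fromℕ (toℕ r)) t₁ (p₁ t₁)) →
    ((t₂ : ℕ) → 1 ≤ t₂ → IsPebblingNumber (suc (n ∸ suc (toℕ r))) k zero t₂ (p₂ t₂)) →
    (t : ℕ) → 1 ≤ t →
    IsPebblingNumber n k r t (maxSplit p₁ p₂ t)
corollary18 n k _ _ r _ r<n-1 p₁ p₂ π₁ π₂ t _ = gluing-pebblingNumber (interior r r<n-1) p₁ p₂ π₁ π₂ t
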